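{- Let $p$ be a prime, let $K$ be a finite extension of $\mathbb{Q}_p$, and let $\mathfrak{p}$ be the unique maximal ideal of $\mathcal{O}_K$. For every $x \in K$ the following hold. (1) If $\nu_{\mathfrak{p}}(\nu_{\mathfrak{p}}(x)) \geq 0$ or $\nu_{\mathfrak{p}}(x) \in \{0, +\infty\}$, then the $\nu_{\mathfrak{p}}$ sequence of $x$ is eventually periodic of period $\leq p$. (2) If $\nu_{\mathfrak{p}}(\nu_{\mathfrak{p}}(x)) < 0$, then the $\nu_{\mathfrak{p}}$ sequence of $x$ converges to $-\infty$. (3) The $\nu_{\mathfrak{p}}$ sequence of $x$ is eventually $+\infty$ if and only if $\nu_{\mathfrak{p}}(x) \in \{0, 1, \ldots, p-1, +\infty\}$.
   Context: $\nu_{\mathfrak{p}}: K \to \mathbb{Q}\cup\{+\infty\}$ denotes the unique discrete valuation on $K$ extending the $p$-adic valuation $\nu_p$ of $\mathbb{Q}_p$ (so $\nu_{\mathfrak{p}}(p)=1$ and $\nu_{\mathfrak{p}}(K^\times) = \frac{1}{e}\mathbb{Z}$, $e$ the ramification index). For a rational number $r$, $\nu_{\mathfrak{p}}(r)=\nu_p(r)$, with $\nu_{\mathfrak{p}}(0)=+\infty$. The arithmetic partial derivative $D_{K,\mathfrak{p}}: K \to K$ is defined by $D_{K,\mathfrak{p}}(x) = x\,\nu_{\mathfrak{p}}(x)/p$ for $x \neq 0$ and $D_{K,\mathfrak{p}}(0) = 0$. The $\nu_{\mathfrak{p}}$ sequence of $x$ is the sequence $\nu_{\mathfrak{p}}(x),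 \nu_{\mathfrak{p}}(D_{K,\mathfrak{p}}(x)), \nu_{\mathfrak{p}}(D_{K,\mathfrak{p}}^2(x)), \ldots$, where $D_{K,\mathfrak{p}}^i$ denotes the $i$-th iterate. -}

module Defs where

open import Level using (Level; _⊔_) renaming (suc to lsuc)
open import Data.Nat as ℕ using (ℕ; zero; suc; _%_; _/_)
open import Data.Integer as ℤ using (ℤ; +_; ∣_∣)
open import Data.Rational as ℚ using (ℚ; ↥_; ↧ₙ_; 0ℚ)
open import Data.Product using (Σ; ∃; _×_)
open import Relation.Binary.PropositionalEquality using (_≡_)
open import Relation.Nullary using (¬_)
open import Data.Empty using (⊥)
open import Data.Unit using (⊤)
open import Algebra.Bundles using (CommutativeRing)

data ℚ∞ : Set where
  fin : ℚ → ℚ∞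
  ∞   : ℚ∞

_<∞_ : ℚ∞ → ℚ∞ → Set
fin a <∞ fin b = a ℚ.< b
fin a <∞ ∞     = ⊤
∞     <∞ _     = ⊥

_≤∞_ : ℚ∞ → ℚ∞ → Set
fin a ≤∞ fin b = a ℚ.≤ b
_     ≤∞ ∞     = ⊤
∞     ≤∞ fin _ = ⊥

_+∞_ : ℚ∞ → ℚ∞ → ℚ∞
fin a +∞ fin b = fin (a ℚ.+ b)
_     +∞ _     = ∞

min∞ : ℚ∞ → ℚ∞ → ℚ∞
min∞ (fin a) (fin b) = fin (a ℚ.⊓ b)
min∞ (fin a) ∞       = fin a
min∞ ∞       b       = b

-- multAux fuel p n : exponent of p in n (fuel n suffices for n ≥ 1, p ≥ 2)
multAux : ℕ → ℕ → ℕ → ℕ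
multAux zero    _       _ = 0
multAux (suc f) zero    _ = 0
multAux (suc f) (suc q) n with n % suc q
... | zero  = suc (multAux f (suc q) (n / suc q))
... | suc _ = 0

mult : ℕ → ℕ → ℕ
mult p n = multAux n p n

νp : ℕ → ℚ → ℚ∞
νp p r with ↥ r
... | + zero = ∞
... | num    = fin ((+ mult p ∣ num ∣ ℤ.- + mult p (↧ₙ r)) ℚ./ 1)

-- 1/p as a rational (p is a prime, so the zero case never occurs)
invP : ℕ → ℚ
invP zero    = 0ℚ
invP (suc n) = (+ 1) ℚ./ suc n

-- A field K containing ℚ, with a discrete valuation ν : K → ℚ ∪ {+∞}
-- extending the p-adic valuation of ℚ (value group (1/e)ℤ).
record ValuedExtension (p : ℕ) (c ℓ : Level) : Set (lsuc (c ⊔ ℓ)) where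
  field
    fieldK : CommutativeRing c ℓ
  open CommutativeRing fieldK public
  field
    0≉1     : ¬ (0# ≈ 1#)
    inverse : ∀ x → ¬ (x ≈ 0#) → ∃ λ y → (x * y) ≈ 1#
    ι       : ℚ → Carrier
    ι-+     : ∀ a b → ι (a ℚ.+ b) ≈ (ι a + ι b)
    ι-*     : ∀ a b → ι (a ℚ.* b) ≈ (ι a * ι b)
    ι-1     : ι ℚ.1ℚ ≈ 1#
    ν       : Carrier → ℚ∞
    ν-cong  : ∀ {x y} → x ≈ y → ν x ≡ ν y
    ν-∞⇒0   : ∀ x → ν x ≡ ∞ → x ≈ 0#
    ν-0     : ν 0# ≡ ∞
    ν-*     : ∀ x y → ν (x * y) ≡ (ν x +∞ ν y)
    ν-+     : ∀ x y → min∞ (ν x) (ν y) ≤∞ ν (x + y)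
    ν-ι     : ∀ r → ν (ι r) ≡ νp p r
    e-1     : ℕ
    ν-discrete : ∀ x q → ν x ≡ fin q → ∃ λ (k : ℤ) → q ≡ (k ℚ./ suc e-1)

  D : Carrier → Carrier
  D x with ν x
  ... | fin q = x * ι (q ℚ.* invP p)
  ... | ∞     = 0#

  Diter : ℕ → Carrier → Carrier
  Diter zero    x = x
  Diter (suc i) x = D (Diter i x)

  νseq : Carrier → ℕ → ℚ∞
  νseq x i = ν (Diter i x)

EventuallyPeriodicWithPeriod≤ : ℕ → (ℕ → ℚ∞) → Set
EventuallyPeriodicWithPeriod≤ p s =
  ∃ λ N → ∃ λ T → 1 ℕ.≤ T × T ℕ.≤ p × (∀ n → N ℕ.≤ n → s (T ℕ.+ n) ≡ s n)

ConvergesToMinusInfinity : (ℕ → ℚ∞) → Set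
ConvergesToMinusInfinity s = ∀ (M : ℚ) → ∃ λ N → ∀ n → N ℕ.≤ n → s n <∞ fin M

EventuallyInfinity : (ℕ → ℚ∞) → Set
EventuallyInfinity s = ∃ λ N → ∀ n → N ℕ.≤ n → s n ≡ ∞

module Submission where

-- Write v for the p-adic valuation on ℚ. Since ν(1/p) = -1, one application of D maps a
-- valuation q to q + v(q) - 1, and 0 and ∞ to ∞; so the ν sequence is an orbit of this map.
-- If v(q) = c < 0, adding the integer c - 1 keeps the valuation c, and the orbit decreases
-- by at least 2 at each step. If v(q) = s with 1 ≤ s ≤ p, the orbit q, q + s - 1, q + s - 2,
-- ..., q + 1, q closes after s steps, because the offsets 1, ..., s - 1 are prime to p; if
-- s > p it walks down from q + s - 1 to q + m, m the largest multiple of p below s, whose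
-- valuation v(m) is smaller than s, and one inducts on s. If v(q) = 0, then q ≡ r (mod p)
-- for some r < p and the orbit walks down to q - r, of valuation at least 1. Finally, ∞ is
-- only reached through 0, and an integer j < p only has j + 1 as a preimage.

open import Defs
open import Level using (Level)
open import Data.Nat as ℕ using (ℕ; zero; suc; z≤n; s≤s)
import Data.Nat.Properties as ℕP
open import Data.Nat.Divisibility
  using (_∣_; _∣?_; ∣⇒≤; m%n≡0⇒n∣m; n∣m⇒m%n≡0; ∣m+n∣m⇒∣n; n∣m*n)
import Data.Nat.DivMod as ℕDM
open import Data.Nat.Primality using (Prime; prime⇒nonTrivial; prime⇒irreducible)
import Data.Nat.Coprimality as Coprime
open import Data.Nat.GCD using (module Bézout)
open import Data.Integer as ℤ using (ℤ; +_; -[1+_]; +[1+_]; ∣_∣)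
import Data.Integer.Properties as ℤP
import Data.Integer.DivMod as ℤDM
open import Data.Rational as ℚ using (ℚ; mkℚ; 0ℚ; ↥_)
import Data.Rational.Properties as ℚP
open import Data.Rational.Solver using (module +-*-Solver)
import Data.Integer.Solver as ℤS
import Data.Rational.Unnormalised as ℚᵘ
open import Data.Product using (∃; _×_; _,_; map₁)
open import Data.Sum using (_⊎_; inj₁; inj₂; [_,_])
open import Data.Unit using (⊤; tt)
open import Data.Empty using (⊥-elim)
open import Relation.Nullary using (¬_; yes; no)
open import Relation.Nullary.Decidable using (decidable-stable)
open import Data.Nat.Induction using (<-rec)
open import Relation.Binary.PropositionalEquality
  using (_≡_; refl; sym; trans; cong; cong₂; subst; subst₂; module ≡-Reasoning)
open import Function.Bundles using (_⇔_; mk⇔)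

-- Integers inside ℚ

fromℤ : ℤ → ℚ
fromℤ z = z ℚ./ 1

fromℤ≡mkℚ : ∀ z → fromℤ z ≡ mkℚ z 0 (Coprime.sym (Coprime.1-coprimeTo ∣ z ∣))
fromℤ≡mkℚ (+ n)    = ℚP.normalize-coprime (Coprime.sym (Coprime.1-coprimeTo n))
fromℤ≡mkℚ -[1+ n ] = cong ℚ.-_ (ℚP.normalize-coprime (Coprime.sym (Coprime.1-coprimeTo (suc n))))

↥-fromℤ : ∀ z → ↥ fromℤ z ≡ z
↥-fromℤ z = cong ↥_ (fromℤ≡mkℚ z)

fromℤ-injective : ∀ {a b} → fromℤ a ≡ fromℤ b → a ≡ b
fromℤ-injective {a} {b} eq = trans (sym (↥-fromℤ a)) (trans (cong ↥_ eq) (↥-fromℤ b))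

fromℤ-homo-+ : ∀ a b → fromℤ (a ℤ.+ b) ≡ fromℤ a ℚ.+ fromℤ b
fromℤ-homo-+ a b rewrite fromℤ≡mkℚ a | fromℤ≡mkℚ b =
  cong (ℚ._/ 1) (sym (cong₂ ℤ._+_ (ℤP.*-identityʳ a) (ℤP.*-identityʳ b)))

fromℤ-homo-* : ∀ a b → fromℤ (a ℤ.* b) ≡ fromℤ a ℚ.* fromℤ b
fromℤ-homo-* a b rewrite fromℤ≡mkℚ a | fromℤ≡mkℚ b = refl

fromℤ-mono-≤ : ∀ {a b} → a ℤ.≤ b → fromℤ a ℚ.≤ fromℤ b
fromℤ-mono-≤ {a} {b} a≤b rewrite fromℤ≡mkℚ a | fromℤ≡mkℚ b =
  ℚ.*≤* (subst₂ ℤ._≤_ (sym (ℤP.*-identityʳ a)) (sym (ℤP.*-identityʳ b)) a≤b)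

fromℤ-cancel-≤ : ∀ {a b} → fromℤ a ℚ.≤ fromℤ b → a ℤ.≤ b
fromℤ-cancel-≤ {a} {b} a≤b rewrite fromℤ≡mkℚ a | fromℤ≡mkℚ b =
  subst₂ ℤ._≤_ (ℤP.*-identityʳ a) (ℤP.*-identityʳ b) (ℚP.drop-*≤* a≤b)

fromℤ-cancel-< : ∀ {a b} → fromℤ a ℚ.< fromℤ b → a ℤ.< b
fromℤ-cancel-< {a} {b} a<b rewrite fromℤ≡mkℚ a | fromℤ≡mkℚ b =
  subst₂ ℤ._<_ (ℤP.*-identityʳ a) (ℤP.*-identityʳ b) (ℚP.drop-*<* a<b)

fromℤ-homo-neg : ∀ a → fromℤ (ℤ.- a) ≡ ℚ.- fromℤ a
fromℤ-homo-neg (+ zero)   = refl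
fromℤ-homo-neg +[1+ n ] rewrite fromℤ≡mkℚ -[1+ n ] = refl
fromℤ-homo-neg -[1+ n ] rewrite fromℤ≡mkℚ +[1+ n ] = refl

a+b-b≡a : ∀ a b → a ℚ.+ b ℚ.- b ≡ a
a+b-b≡a = solve 2 (λ a b → a :+ b :- b := a) refl
  where open +-*-Solver

a-b+b≡a : ∀ a b → a ℚ.- b ℚ.+ b ≡ a
a-b+b≡a = solve 2 (λ a b → a :- b :+ b := a) refl
  where open +-*-Solver

+-fromℤ-assoc : ∀ y a b → y ℚ.+ fromℤ a ℚ.+ fromℤ b ≡ y ℚ.+ fromℤ (a ℤ.+ b)
+-fromℤ-assoc y a b = trans (ℚP.+-assoc y (fromℤ a) (fromℤ b)) (cong (y ℚ.+_) (sym (fromℤ-homo-+ a b)))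

y+a≡b⇒y≡b-a : ∀ {y a b} → y ℚ.+ fromℤ a ≡ fromℤ b → y ≡ fromℤ (b ℤ.- a)
y+a≡b⇒y≡b-a {y} {a} {b} y+a≡b = begin
  y                           ≡⟨ a+b-b≡a y (fromℤ a) ⟨
  y ℚ.+ fromℤ a ℚ.- fromℤ a   ≡⟨ cong (ℚ._- fromℤ a) y+a≡b ⟩
  fromℤ b ℚ.- fromℤ a         ≡⟨ cong (fromℤ b ℚ.+_) (fromℤ-homo-neg a) ⟨
  fromℤ b ℚ.+ fromℤ (ℤ.- a)   ≡⟨ fromℤ-homo-+ b (ℤ.- a) ⟨
  fromℤ (b ℤ.- a)             ∎
  where open ≡-Reasoning

q*↧q≡↥q : ∀ q → q ℚ.* fromℤ (ℚ.↧ q) ≡ fromℤ (↥ q)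
q*↧q≡↥q (mkℚ n d _) rewrite fromℤ≡mkℚ (+ suc d) =
  ℚP.fromℚᵘ-cong {ℚᵘ.mkℚᵘ (n ℤ.* + suc d) (d ℕ.* 1)} {ℚᵘ.mkℚᵘ n 0}
    (ℚᵘ.*≡* (trans (ℤP.*-identityʳ _) (cong (λ e → n ℤ.* + suc e) (sym (ℕP.*-identityʳ d)))))

q-r≡P*[q*a+t] : ∀ q a b d n r t P →
                q ℚ.* d ≡ n → a ℚ.* P ℚ.+ b ℚ.* d ≡ ℚ.1ℚ → n ℚ.* b ≡ r ℚ.+ t ℚ.* P →
                q ℚ.- r ≡ P ℚ.* (q ℚ.* a ℚ.+ t)
q-r≡P*[q*a+t] q a b d n r t P qd≡n ap+bd≡1 nb≡r+tP = begin
  q ℚ.- r                                   ≡⟨ cong (ℚ._- r) (ℚP.*-identityʳ q) ⟨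
  q ℚ.* ℚ.1ℚ ℚ.- r                          ≡⟨ cong (λ x → q ℚ.* x ℚ.- r) ap+bd≡1 ⟨
  q ℚ.* (a ℚ.* P ℚ.+ b ℚ.* d) ℚ.- r         ≡⟨ solve 6 (λ q a P b d r → q :* (a :* P :+ b :* d) :- r
                                                  := q :* a :* P :+ (q :* d) :* b :- r) refl q a P b d r ⟩
  q ℚ.* a ℚ.* P ℚ.+ (q ℚ.* d) ℚ.* b ℚ.- r   ≡⟨ cong (λ x → q ℚ.* a ℚ.* P ℚ.+ x ℚ.* b ℚ.- r) qd≡n ⟩
  q ℚ.* a ℚ.* P ℚ.+ n ℚ.* b ℚ.- r           ≡⟨ cong (λ x → q ℚ.* a ℚ.* P ℚ.+ x ℚ.- r) nb≡r+tP ⟩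
  q ℚ.* a ℚ.* P ℚ.+ (r ℚ.+ t ℚ.* P) ℚ.- r   ≡⟨ solve 5 (λ q a P r t → q :* a :* P :+ (r :+ t :* P) :- r
                                                  := P :* (q :* a :+ t)) refl q a P r t ⟩
  P ℚ.* (q ℚ.* a ℚ.+ t)                     ∎
  where open ≡-Reasoning; open +-*-Solver

pos-1+y*n≡x*m : ∀ x y m n → 1 ℕ.+ y ℕ.* n ≡ x ℕ.* m → + 1 ℤ.+ + y ℤ.* + n ≡ + x ℤ.* + m
pos-1+y*n≡x*m x y m n eq = trans (cong (ℤ._+_ (+ 1)) (sym (ℤP.pos-* y n)))
  (trans (sym (ℤP.pos-+ 1 (y ℕ.* n))) (trans (cong +_ eq) (ℤP.pos-* x m)))

bézout-ℤ : ∀ {m n} → Bézout.Identity 1 m n → ∃ λ a → ∃ λ b → a ℤ.* + m ℤ.+ b ℤ.* + n ≡ + 1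
bézout-ℤ {m} {n} (Bézout.+- x y 1+yn≡xm) = + x , ℤ.- + y , (begin
  + x ℤ.* + m ℤ.+ ℤ.- + y ℤ.* + n
    ≡⟨ cong (ℤ._+ ℤ.- + y ℤ.* + n) (pos-1+y*n≡x*m x y m n 1+yn≡xm) ⟨
  + 1 ℤ.+ + y ℤ.* + n ℤ.+ ℤ.- + y ℤ.* + n
    ≡⟨ solve 2 (λ y n → con (+ 1) :+ y :* n :+ (:- y) :* n := con (+ 1)) refl (+ y) (+ n) ⟩
  + 1                                        ∎)
  where open ≡-Reasoning; open ℤS.+-*-Solver
bézout-ℤ {m} {n} (Bézout.-+ x y 1+xm≡yn) = ℤ.- + x , + y , (begin
  ℤ.- + x ℤ.* + m ℤ.+ + y ℤ.* + n
    ≡⟨ cong (ℤ._+_ (ℤ.- + x ℤ.* + m)) (pos-1+y*n≡x*m y x n m 1+xm≡yn) ⟨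
  ℤ.- + x ℤ.* + m ℤ.+ (+ 1 ℤ.+ + x ℤ.* + m)
    ≡⟨ solve 2 (λ x m → (:- x) :* m :+ (con (+ 1) :+ x :* m) := con (+ 1)) refl (+ x) (+ m) ⟩
  + 1                                        ∎)
  where open ≡-Reasoning; open ℤS.+-*-Solver

prime∧∤⇒coprime : ∀ {p n} → Prime p → ¬ (p ∣ n) → Coprime.Coprime p n
prime∧∤⇒coprime p-prime p∤n {i} (i∣p , i∣n) with prime⇒irreducible p-prime i∣p
... | inj₁ i≡1 = i≡1
... | inj₂ i≡p = ⊥-elim (p∤n (subst (_∣ _) i≡p i∣n))

i≤+∣i∣ : ∀ i → i ℤ.≤ + ∣ i ∣
i≤+∣i∣ (+ _)    = ℤP.≤-refl
i≤+∣i∣ -[1+ _ ] = ℤ.-≤+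

fromℤ-unbounded : ∀ t → ∃ λ (N : ℕ) → t ℚ.< fromℤ (+ N)
fromℤ-unbounded t@(mkℚ n d _) = suc ∣ n ∣ , subst (t ℚ.<_) (sym (fromℤ≡mkℚ (+ suc ∣ n ∣)))
  (ℚ.*<* (subst (ℤ._< + suc ∣ n ∣ ℤ.* + suc d) (sym (ℤP.*-identityʳ n))
    (ℤP.≤-<-trans (i≤+∣i∣ n) (subst (+ ∣ n ∣ ℤ.<_) (ℤP.pos-* (suc ∣ n ∣) (suc d))
      (ℤ.+<+ (ℕP.m≤m*n (suc ∣ n ∣) (suc d)))))))

archimedean : ∀ q M → ∃ λ (N : ℕ) → q ℚ.+ fromℤ (ℤ.- + N) ℚ.< M
archimedean q M with fromℤ-unbounded (q ℚ.- M)
... | N , q-M<N = N , subst₂ ℚ._<_ lhs≡ rhs≡ (ℚP.+-monoˡ-< (M ℚ.- fromℤ (+ N)) q-M<N)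
  where
    open +-*-Solver
    lhs≡ : q ℚ.- M ℚ.+ (M ℚ.- fromℤ (+ N)) ≡ q ℚ.+ fromℤ (ℤ.- + N)
    lhs≡ = trans (solve 3 (λ q M N → q :- M :+ (M :- N) := q :- N) refl q M (fromℤ (+ N)))
                 (cong (q ℚ.+_) (sym (fromℤ-homo-neg (+ N))))
    rhs≡ : fromℤ (+ N) ℚ.+ (M ℚ.- fromℤ (+ N)) ≡ M
    rhs≡ = solve 2 (λ M N → N :+ (M :- N) := M) refl M (fromℤ (+ N))

-- Valuations with values in ℤ ∪ {∞}

data ℤ∞ : Set where
  int : ℤ → ℤ∞
  ∞ᶻ  : ℤ∞

⟦_⟧ : ℤ∞ → ℚ∞
⟦ int z ⟧ = fin (fromℤ z)
⟦ ∞ᶻ ⟧    = ∞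

infixl 6 _+ᶻ_
infix 4 _≤ᶻ_

_+ᶻ_ : ℤ∞ → ℤ∞ → ℤ∞
int a +ᶻ int b = int (a ℤ.+ b)
_     +ᶻ _     = ∞ᶻ

_≤ᶻ_ : ℤ → ℤ∞ → Set
c ≤ᶻ int z = c ℤ.≤ z
c ≤ᶻ ∞ᶻ    = ⊤

fin-injective : ∀ {a b} → fin a ≡ fin b → a ≡ b
fin-injective refl = refl

⟦⟧-injective : ∀ {A B} → ⟦ A ⟧ ≡ ⟦ B ⟧ → A ≡ B
⟦⟧-injective {int a} {int b} eq = cong int (fromℤ-injective (fin-injective eq))
⟦⟧-injective {∞ᶻ}    {∞ᶻ}    _  = refl

⟦⟧-homo-+ : ∀ A B → ⟦ A +ᶻ B ⟧ ≡ ⟦ A ⟧ +∞ ⟦ B ⟧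
⟦⟧-homo-+ (int a) (int b) = cong fin (fromℤ-homo-+ a b)
⟦⟧-homo-+ (int a) ∞ᶻ      = refl
⟦⟧-homo-+ ∞ᶻ      _       = refl

≤ᶻ-reflexive : ∀ {A c} → A ≡ int c → c ≤ᶻ A
≤ᶻ-reflexive refl = ℤP.≤-refl

≤ᶻ-weaken : ∀ {b c} A → b ℤ.≤ c → c ≤ᶻ A → b ≤ᶻ A
≤ᶻ-weaken (int a) b≤c c≤a = ℤP.≤-trans b≤c c≤a
≤ᶻ-weaken ∞ᶻ      _   _   = tt

int-injective : ∀ {a b} → int a ≡ int b → a ≡ b
int-injective refl = refl

≤ᶻ-+ : ∀ {a b} A B → a ≤ᶻ A → b ≤ᶻ B → a ℤ.+ b ≤ᶻ A +ᶻ B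
≤ᶻ-+ (int x) (int y) a≤x b≤y = ℤP.+-mono-≤ a≤x b≤y
≤ᶻ-+ (int x) ∞ᶻ      _   _   = tt
≤ᶻ-+ ∞ᶻ      _       _   _   = tt

0≤ᶻ⇒≡0⊎1≤ᶻ : ∀ A → + 0 ≤ᶻ A → A ≡ int (+ 0) ⊎ + 1 ≤ᶻ A
0≤ᶻ⇒≡0⊎1≤ᶻ (int (+ zero))  _ = inj₁ refl
0≤ᶻ⇒≡0⊎1≤ᶻ (int +[1+ n ]) _ = inj₂ (ℤ.+≤+ (s≤s z≤n))
0≤ᶻ⇒≡0⊎1≤ᶻ ∞ᶻ             _ = inj₂ tt

⟦⟧-cancel-≤ : ∀ c A → fin (fromℤ c) ≤∞ ⟦ A ⟧ → c ≤ᶻ A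
⟦⟧-cancel-≤ c (int a) c≤a = fromℤ-cancel-≤ c≤a
⟦⟧-cancel-≤ c ∞ᶻ      _   = tt

⟦⟧<0⇒negative : ∀ A → ⟦ A ⟧ <∞ fin 0ℚ → ∃ λ c → c ℤ.< + 0 × A ≡ int c
⟦⟧<0⇒negative (int a) a<0 = a , fromℤ-cancel-< a<0 , refl

≤ᶻ-≮⇒≡ : ∀ {m} A → m ≤ᶻ A → ¬ (ℤ.suc m ≤ᶻ A) → A ≡ int m
≤ᶻ-≮⇒≡     ∞ᶻ      _   m≮A = ⊥-elim (m≮A tt)
≤ᶻ-≮⇒≡ {m} (int a) m≤a m≮a with a ℤ.≟ m
... | yes a≡m = cong int a≡m
... | no  a≢m = ⊥-elim (m≮a (ℤP.i<j⇒suc[i]≤j (ℤP.≤∧≢⇒< m≤a (λ m≡a → a≢m (sym m≡a)))))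

≤ᶻ-min : ∀ c A B C → c ≤ᶻ A → c ≤ᶻ B → min∞ ⟦ A ⟧ ⟦ B ⟧ ≤∞ ⟦ C ⟧ → c ≤ᶻ C
≤ᶻ-min c A       B       ∞ᶻ      _   _   _ = tt
≤ᶻ-min c (int a) (int b) (int z) c≤a c≤b m =
  fromℤ-cancel-≤ (ℚP.≤-trans (ℚP.⊓-glb (fromℤ-mono-≤ c≤a) (fromℤ-mono-≤ c≤b)) m)
≤ᶻ-min c (int a) ∞ᶻ      (int z) c≤a _   m = ℤP.≤-trans c≤a (fromℤ-cancel-≤ m)
≤ᶻ-min c ∞ᶻ      (int b) (int z) _   c≤b m = ℤP.≤-trans c≤b (fromℤ-cancel-≤ m)

-- Orbits

from-offset : ∀ {P : ℕ → Set} N → (∀ d → P (d ℕ.+ N)) → ∀ n → N ℕ.≤ n → P n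
from-offset {P} N P[d+N] n N≤n = subst P (ℕP.m∸n+n≡m N≤n) (P[d+N] (n ℕ.∸ N))

module Orbit {A : Set} (f : A → A) (u : ℕ → A) (u-suc : ∀ n → u (suc n) ≡ f (u n)) where

  fixed-point-absorbs : ∀ {a N} → f a ≡ a → u N ≡ a → ∀ d → u (d ℕ.+ N) ≡ a
  fixed-point-absorbs fa≡a uN≡a zero    = uN≡a
  fixed-point-absorbs fa≡a uN≡a (suc d) =
    trans (u-suc _) (trans (cong f (fixed-point-absorbs fa≡a uN≡a d)) fa≡a)

  return⇒periodic : ∀ {N T} → u (T ℕ.+ N) ≡ u N → ∀ d → u (T ℕ.+ (d ℕ.+ N)) ≡ u (d ℕ.+ N)
  return⇒periodic         ret zero    = ret
  return⇒periodic {N} {T} ret (suc d) = begin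
    u (T ℕ.+ suc (d ℕ.+ N))   ≡⟨ cong u (ℕP.+-suc T (d ℕ.+ N)) ⟩
    u (suc (T ℕ.+ (d ℕ.+ N))) ≡⟨ u-suc _ ⟩
    f (u (T ℕ.+ (d ℕ.+ N)))   ≡⟨ cong f (return⇒periodic ret d) ⟩
    f (u (d ℕ.+ N))           ≡⟨ u-suc _ ⟨
    u (suc (d ℕ.+ N))         ∎
    where open ≡-Reasoning

-- The p-adic valuation on ℚ

-- p is written k + 2 so that it is a successor, as required by multAux, invP and ℕ division.
module PAdicValuation (k : ℕ) where

  p : ℕ
  p = suc (suc k)

  multAux-∣ : ∀ f n → n ℕ.% p ≡ 0 → multAux (suc f) p n ≡ suc (multAux f p (n ℕ./ p))
  multAux-∣ f n p∣n with n ℕ.% p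
  ... | zero = refl

  multAux-∤ : ∀ f n → ¬ (n ℕ.% p ≡ 0) → multAux (suc f) p n ≡ 0
  multAux-∤ f n p∤n with n ℕ.% p
  ... | zero  = ⊥-elim (p∤n refl)
  ... | suc _ = refl

  multAux-< : ∀ f n .{{_ : ℕ.NonZero n}} → multAux f p n ℕ.< n
  multAux-< zero    n = ℕ.>-nonZero⁻¹ n
  multAux-< (suc f) n with n ℕ.% p ℕ.≟ 0
  ... | no  p∤n rewrite multAux-∤ f n p∤n = ℕ.>-nonZero⁻¹ n
  ... | yes p∣n rewrite multAux-∣ f n p∣n =
    ℕP.≤-trans (s≤s (multAux-< f (n ℕ./ p) {{ℕ.>-nonZero n/p>0}})) (ℕDM.m/n<m n p (s≤s (s≤s z≤n)))
    where n/p>0 = ℕDM.m≥n⇒m/n>0 (∣⇒≤ (m%n≡0⇒n∣m n p p∣n))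

  mult-< : ∀ n .{{_ : ℕ.NonZero n}} → mult p n ℕ.< n
  mult-< n = multAux-< n n

  ∤⇒mult≡0 : ∀ n → ¬ (p ∣ n) → mult p n ≡ 0
  ∤⇒mult≡0 zero    _   = refl
  ∤⇒mult≡0 (suc n) p∤n = multAux-∤ n (suc n) (λ eq → p∤n (m%n≡0⇒n∣m (suc n) p eq))

  ∣⇒mult>0 : ∀ n .{{_ : ℕ.NonZero n}} → p ∣ n → 0 ℕ.< mult p n
  ∣⇒mult>0 (suc n) p∣n rewrite multAux-∣ n (suc n) (n∣m⇒m%n≡0 (suc n) p p∣n) = s≤s z≤n

  mult-p≡1 : mult p p ≡ 1
  mult-p≡1 = trans (multAux-∣ (suc k) p (ℕDM.n%n≡0 p)) (cong (λ n → suc (multAux (suc k) p n)) (ℕDM.n/n≡1 p))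

  v : ℚ → ℤ∞
  v (mkℚ (+ zero) _ _) = ∞ᶻ
  v (mkℚ n d _)        = int (+ mult p ∣ n ∣ ℤ.- + mult p (suc d))

  νp≡⟦v⟧ : ∀ r → νp p r ≡ ⟦ v r ⟧
  νp≡⟦v⟧ (mkℚ (+ zero)   _ _) = refl
  νp≡⟦v⟧ (mkℚ +[1+ _ ] _ _) = refl
  νp≡⟦v⟧ (mkℚ -[1+ _ ] _ _) = refl

  v-neg : ∀ r → v (ℚ.- r) ≡ v r
  v-neg (mkℚ (+ zero)   _ _) = refl
  v-neg (mkℚ +[1+ _ ] _ _) = refl
  v-neg (mkℚ -[1+ _ ] _ _) = refl

  v≡∞⇒≡0 : ∀ r → v r ≡ ∞ᶻ → r ≡ 0ℚ
  v≡∞⇒≡0 r@(mkℚ (+ zero) _ _) _ = ℚP.↥p≡0⇒p≡0 r refl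

  v-fromℤ : (z : ℤ) .{{_ : ℤ.NonZero z}} → v (fromℤ z) ≡ int (+ mult p ∣ z ∣)
  v-fromℤ z rewrite fromℤ≡mkℚ z with z
  ... | +[1+ n ] = cong int (ℤP.+-identityʳ (+ mult p (suc n)))
  ... | -[1+ n ] = cong int (ℤP.+-identityʳ (+ mult p (suc n)))

  v-fromℤ-nonneg : ∀ z → + 0 ≤ᶻ v (fromℤ z)
  v-fromℤ-nonneg (+ zero)   = tt
  v-fromℤ-nonneg z@(+[1+ _ ]) rewrite v-fromℤ z {{_}} = ℤ.+≤+ z≤n
  v-fromℤ-nonneg z@(-[1+ _ ]) rewrite v-fromℤ z {{_}} = ℤ.+≤+ z≤n

  v-1/p : v (invP p) ≡ int (ℤ.- + 1)
  v-1/p rewrite ℚP.normalize-coprime {1} {suc k} (Coprime.1-coprimeTo p) | mult-p≡1 = refl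

  νp-nonneg⇒ : ∀ q → fin 0ℚ ≤∞ νp p q → + 0 ≤ᶻ v q
  νp-nonneg⇒ q 0≤νq = ⟦⟧-cancel-≤ (+ 0) (v q) (subst (fin 0ℚ ≤∞_) (νp≡⟦v⟧ q) 0≤νq)

  νp-negative⇒ : ∀ q → νp p q <∞ fin 0ℚ → ∃ λ c → c ℤ.< + 0 × v q ≡ int c
  νp-negative⇒ q νq<0 = ⟦⟧<0⇒negative (v q) (subst (_<∞ fin 0ℚ) (νp≡⟦v⟧ q) νq<0)

  -- step (fin 0ℚ) = ∞, as νp 0 = ∞.
  stepBy : ℚ → ℤ∞ → ℚ∞
  stepBy q (int c) = fin (q ℚ.+ fromℤ (c ℤ.- + 1))
  stepBy q ∞ᶻ      = ∞

  step : ℚ∞ → ℚ∞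
  step (fin q) = stepBy q (v q)
  step ∞       = ∞

  small⇒∤ : ∀ n → 0 ℕ.< n → n ℕ.< p → ¬ (p ∣ n)
  small⇒∤ n 0<n n<p p∣n = ℕP.<⇒≱ n<p (∣⇒≤ {{ℕ.>-nonZero 0<n}} p∣n)

  small+multiple⇒∤ : ∀ n q → 0 ℕ.< n → n ℕ.< p → ¬ (p ∣ n ℕ.+ q ℕ.* p)
  small+multiple⇒∤ n q 0<n n<p p∣n+qp =
    small⇒∤ n 0<n n<p (∣m+n∣m⇒∣n (subst (p ∣_) (ℕP.+-comm n (q ℕ.* p)) p∣n+qp) (n∣m*n q))

  mult≢0⇒∣ : ∀ n → ¬ (mult p n ≡ 0) → p ∣ n
  mult≢0⇒∣ n mult≢0 = decidable-stable (p ∣? n) (λ p∤n → mult≢0 (∤⇒mult≡0 n p∤n))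

  equal-mult⇒∤ : ∀ m d → Coprime.Coprime (suc m) (suc d) → mult p (suc m) ≡ mult p (suc d) → ¬ (p ∣ suc d)
  equal-mult⇒∤ m d coprime mult≡ p∣D = p≢1 (coprime (p∣m+1 , p∣D))
    where
      p≢1 : ¬ (p ≡ 1)
      p≢1 ()
      p∣m+1 = mult≢0⇒∣ (suc m) λ mult≡0 →
        ℕP.<⇒≢ (∣⇒mult>0 (suc d) p∣D) (sym (trans (sym mult≡) mult≡0))

  v≡0⇒p∤↧ : ∀ q → v q ≡ int (+ 0) → ¬ (p ∣ ℚ.↧ₙ q)
  v≡0⇒p∤↧ (mkℚ +[1+ m ] d c) v≡0 =
    equal-mult⇒∤ m d (Coprime.recompute c) (ℤP.+-injective (ℤP.i-j≡0⇒i≡j _ _ (int-injective v≡0)))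
  v≡0⇒p∤↧ (mkℚ -[1+ m ] d c) v≡0 =
    equal-mult⇒∤ m d (Coprime.recompute c) (ℤP.+-injective (ℤP.i-j≡0⇒i≡j _ _ (int-injective v≡0)))

  -- z ≠ 0 and c = νp z < ∣ z ∣. If c = 0 then z = j + 1, and z ≠ p as νp p = 1; if c > 0 then
  -- either 0 < z ≤ j < p is a multiple of p, or z < 0 with ∣ z ∣ ≤ c.
  integral-preimage : ∀ z c j → j ℕ.< p → v (fromℤ z) ≡ int c → z ℤ.+ (c ℤ.- + 1) ≡ + j →
                      z ≡ + suc j × suc j ℕ.< p
  integral-preimage z@(+[1+ n ]) c j j<p vz≡c eq with trans (sym vz≡c) (v-fromℤ z {{_}})
  ... | refl with mult p (suc n) in mult≡ | eq
  ...   | zero  | refl = refl , ℕP.≤∧≢⇒< j<p λ 1+j≡p →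
                           ℕP.1+n≢0 (trans (sym mult-p≡1) (trans (cong (mult p) (sym 1+j≡p)) mult≡))
  ...   | suc t | eq′  = ⊥-elim (small⇒∤ (suc n) (s≤s z≤n) (ℕP.≤-<-trans 1+n≤j j<p)
                                  (mult≢0⇒∣ (suc n) (λ mult≡0 → ℕP.1+n≢0 (trans (sym mult≡) mult≡0))))
    where 1+n≤j = subst (suc n ℕ.≤_) (ℤP.+-injective eq′) (s≤s (ℕP.m≤m+n n t))
  integral-preimage z@(-[1+ n ]) c j j<p vz≡c eq with trans (sym vz≡c) (v-fromℤ z {{_}})
  ... | refl with mult p (suc n) in mult≡ | eq
  ...   | zero  | ()
  ...   | suc t | eq′  = ⊥-elim (-[1+]≢+ (trans (sym -[1+n]+t≡) eq′))
    where
      t≤n = ℕP.<⇒≤ (ℕP.≤-pred (subst (ℕ._< suc n) mult≡ (mult-< (suc n))))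
      -[1+n]+t≡ : -[1+ n ] ℤ.+ + t ≡ -[1+ n ℕ.∸ t ]
      -[1+n]+t≡ = trans (ℤP.⊖-< (s≤s t≤n)) (cong (λ m → ℤ.- + m) (ℕP.+-∸-assoc 1 t≤n))
      -[1+]≢+ : ∀ {a b} → ¬ (-[1+ a ] ≡ + b)
      -[1+]≢+ ()

  step-fin : ∀ {q c} → v q ≡ int c → step (fin q) ≡ fin (q ℚ.+ fromℤ (c ℤ.- + 1))
  step-fin vq≡c rewrite vq≡c = refl

  step-shift : ∀ y z {c} → v (y ℚ.+ fromℤ z) ≡ int c →
               step (fin (y ℚ.+ fromℤ z)) ≡ fin (y ℚ.+ fromℤ (z ℤ.+ (c ℤ.- + 1)))
  step-shift y z {c} v≡c = trans (step-fin v≡c) (cong fin (+-fromℤ-assoc y z (c ℤ.- + 1)))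

  step-fin⁻¹ : ∀ q {y} → step (fin q) ≡ fin y → ∃ λ c → v q ≡ int c × q ℚ.+ fromℤ (c ℤ.- + 1) ≡ y
  step-fin⁻¹ q with v q
  ... | int c = λ step≡y → c , refl , fin-injective step≡y

  step-preimage-small : ∀ w j → j ℕ.< p → step w ≡ fin (fromℤ (+ j)) →
                        w ≡ fin (fromℤ (+ suc j)) × suc j ℕ.< p
  step-preimage-small ∞       j j<p ()
  step-preimage-small (fin q) j j<p step≡j with step-fin⁻¹ q step≡j
  ... | c , vq≡c , q+c-1≡j =
    map₁ (λ z≡1+j → cong fin (trans q≡z (cong fromℤ z≡1+j)))
         (integral-preimage z c j j<p (trans (cong v (sym q≡z)) vq≡c) z+c-1≡j)
    where
      z = + j ℤ.- (c ℤ.- + 1)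
      q≡z : q ≡ fromℤ z
      q≡z = y+a≡b⇒y≡b-a {q} {c ℤ.- + 1} {+ j} q+c-1≡j
      z+c-1≡j : z ℤ.+ (c ℤ.- + 1) ≡ + j
      z+c-1≡j = solve 2 (λ j c → j :- (c :- con (+ 1)) :+ (c :- con (+ 1)) := j) refl (+ j) c
        where open ℤS.+-*-Solver

  step≡∞⇒≡0 : ∀ q → step (fin q) ≡ ∞ → q ≡ 0ℚ
  step≡∞⇒≡0 q with v q in vq≡∞
  ... | ∞ᶻ = λ _ → v≡∞⇒≡0 q vq≡∞

-- ν along iterated derivatives

-- ℚ sits in K through ι, so multiplicativity and the ultrametric inequality of νp are
-- inherited from ν.
module InExtension (k : ℕ) {c ℓ : Level} (K : ValuedExtension (suc (suc k)) c ℓ) where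
  open PAdicValuation k
  open ValuedExtension K using (ν; ι; D; _*_; ν-ι; ν-*; ν-+; ν-cong; ι-*; ι-+; ν-0)
  open ≡-Reasoning

  ν-ι≡⟦v⟧ : ∀ r → ν (ι r) ≡ ⟦ v r ⟧
  ν-ι≡⟦v⟧ r = trans (ν-ι r) (νp≡⟦v⟧ r)

  v-* : ∀ a b → v (a ℚ.* b) ≡ v a +ᶻ v b
  v-* a b = ⟦⟧-injective (begin
    ⟦ v (a ℚ.* b) ⟧      ≡⟨ ν-ι≡⟦v⟧ _ ⟨
    ν (ι (a ℚ.* b))      ≡⟨ ν-cong (ι-* a b) ⟩
    ν (ι a * ι b)        ≡⟨ ν-* _ _ ⟩
    ν (ι a) +∞ ν (ι b)   ≡⟨ cong₂ _+∞_ (ν-ι≡⟦v⟧ a) (ν-ι≡⟦v⟧ b) ⟩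
    ⟦ v a ⟧ +∞ ⟦ v b ⟧   ≡⟨ ⟦⟧-homo-+ (v a) (v b) ⟨
    ⟦ v a +ᶻ v b ⟧       ∎)

  v-ultra : ∀ {m} a b → m ≤ᶻ v a → m ≤ᶻ v b → m ≤ᶻ v (a ℚ.+ b)
  v-ultra a b m≤va m≤vb = ≤ᶻ-min _ (v a) (v b) (v (a ℚ.+ b)) m≤va m≤vb
    (subst₂ _≤∞_ (cong₂ min∞ (ν-ι≡⟦v⟧ a) (ν-ι≡⟦v⟧ b))
                 (trans (sym (ν-cong (ι-+ a b))) (ν-ι≡⟦v⟧ (a ℚ.+ b)))
                 (ν-+ (ι a) (ι b)))

  v-+-not-above : ∀ {m} a b → v a ≡ int m → ℤ.suc m ≤ᶻ v b → ¬ (ℤ.suc m ≤ᶻ v (a ℚ.+ b))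
  v-+-not-above {m} a b va≡m m<vb m<va+b = ℤP.<-irrefl refl (ℤP.suc[i]≤j⇒i<j m<va)
    where
      m<va : ℤ.suc m ≤ᶻ int m
      m<va = subst (ℤ.suc m ≤ᶻ_) (trans (cong v (a+b-b≡a a b)) va≡m)
        (v-ultra (a ℚ.+ b) (ℚ.- b) m<va+b (subst (ℤ.suc m ≤ᶻ_) (sym (v-neg b)) m<vb))

  v-strict : ∀ {m} a b → v a ≡ int m → ℤ.suc m ≤ᶻ v b → v (a ℚ.+ b) ≡ int m
  v-strict {m} a b va≡m m<vb = ≤ᶻ-≮⇒≡ (v (a ℚ.+ b))
    (v-ultra a b (≤ᶻ-reflexive va≡m) (≤ᶻ-weaken (v b) (ℤP.i≤suc[i] m) m<vb))
    (v-+-not-above a b va≡m m<vb)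

  ν-D : ∀ y → ν (D y) ≡ step (ν y)
  ν-D y with ν y in νy≡
  ... | ∞     = ν-0
  ... | fin q = begin
    ν (y * ι (q ℚ.* invP p))             ≡⟨ ν-* _ _ ⟩
    ν y +∞ ν (ι (q ℚ.* invP p))          ≡⟨ cong₂ _+∞_ νy≡ (ν-ι≡⟦v⟧ _) ⟩
    fin q +∞ ⟦ v (q ℚ.* invP p) ⟧        ≡⟨ cong (λ A → fin q +∞ ⟦ A ⟧) v[q/p] ⟩
    fin q +∞ ⟦ v q +ᶻ int (ℤ.- + 1) ⟧    ≡⟨ lower-by-one (v q) ⟩
    step (fin q)                         ∎
    where
      v[q/p] : v (q ℚ.* invP p) ≡ v q +ᶻ int (ℤ.- + 1)
      v[q/p] = trans (v-* q (invP p)) (cong (v q +ᶻ_) v-1/p)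
      lower-by-one : ∀ A → fin q +∞ ⟦ A +ᶻ int (ℤ.- + 1) ⟧ ≡ stepBy q A
      lower-by-one (int c) = refl
      lower-by-one ∞ᶻ      = refl

  step-down : ∀ {y} n → + 1 ≤ᶻ v y → ¬ (p ∣ suc n) →
              step (fin (y ℚ.+ fromℤ (+ suc n))) ≡ fin (y ℚ.+ fromℤ (+ n))
  step-down {y} n 1≤vy p∤ = step-shift y (+ suc n) (trans (cong v (ℚP.+-comm y (fromℤ (+ suc n))))
    (v-strict (fromℤ (+ suc n)) y v[1+n]≡0 1≤vy))
    where
      v[1+n]≡0 : v (fromℤ (+ suc n)) ≡ int (+ 0)
      v[1+n]≡0 = trans (v-fromℤ (+ suc n)) (cong (λ t → int (+ t)) (∤⇒mult≡0 (suc n) p∤))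

  -- Bézout gives a p + b D = 1 for the denominator D of q, which is prime to p; writing
  -- n b = r + t p for the numerator n, q - r = p (q a + t).
  residue : Prime p → ∀ q → v q ≡ int (+ 0) → ∃ λ r → r ℕ.< p × + 1 ≤ᶻ v (q ℚ.- fromℤ (+ r))
  residue p-prime q vq≡0
    with bézout-ℤ (Coprime.coprime-Bézout (prime∧∤⇒coprime p-prime (v≡0⇒p∤↧ q vq≡0)))
  ... | a , b , ap+bD≡1 = r , ℤDM.n%ℕd<d s p ,
    subst (+ 1 ≤ᶻ_) (sym (trans (cong v q-r≡p[qa+t]) (v-* P (q ℚ.* fromℤ a ℚ.+ fromℤ t))))
      (≤ᶻ-+ (v P) _ (≤ᶻ-reflexive v-p) 0≤v[qa+t])
    where
      s = ↥ q ℤ.* b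
      r = s ℤDM.%ℕ p
      t = s ℤDM./ℕ p
      P = fromℤ (+ p)
      q-r≡p[qa+t] : q ℚ.- fromℤ (+ r) ≡ P ℚ.* (q ℚ.* fromℤ a ℚ.+ fromℤ t)
      q-r≡p[qa+t] =
        q-r≡P*[q*a+t] q (fromℤ a) (fromℤ b) (fromℤ (ℚ.↧ q)) (fromℤ (↥ q)) (fromℤ (+ r)) (fromℤ t) P
        (q*↧q≡↥q q)
        (trans (sym (trans (fromℤ-homo-+ (a ℤ.* + p) (b ℤ.* ℚ.↧ q))
                           (cong₂ ℚ._+_ (fromℤ-homo-* a (+ p)) (fromℤ-homo-* b (ℚ.↧ q)))))
               (cong fromℤ ap+bD≡1))
        (trans (sym (fromℤ-homo-* (↥ q) b))
          (trans (cong fromℤ (ℤDM.a≡a%ℕn+[a/ℕn]*n s p))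
            (trans (fromℤ-homo-+ (+ r) (t ℤ.* + p)) (cong (fromℤ (+ r) ℚ.+_) (fromℤ-homo-* t (+ p))))))
      v-p : v P ≡ int (+ 1)
      v-p = trans (v-fromℤ (+ p)) (cong (λ m → int (+ m)) mult-p≡1)
      0≤v[qa+t] : + 0 ≤ᶻ v (q ℚ.* fromℤ a ℚ.+ fromℤ t)
      0≤v[qa+t] = v-ultra (q ℚ.* fromℤ a) (fromℤ t)
        (subst (+ 0 ≤ᶻ_) (sym (v-* q (fromℤ a))) (≤ᶻ-+ (v q) _ (≤ᶻ-reflexive vq≡0) (v-fromℤ-nonneg a)))
        (v-fromℤ-nonneg t)

  module StepOrbit (u : ℕ → ℚ∞) (u-suc : ∀ n → u (suc n) ≡ step (u n)) where
    open Orbit step u u-suc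

    return⇒eventuallyPeriodic : ∀ N T → 1 ℕ.≤ T → T ℕ.≤ p → u (T ℕ.+ N) ≡ u N →
                                EventuallyPeriodicWithPeriod≤ p u
    return⇒eventuallyPeriodic N T 1≤T T≤p ret = N , T , 1≤T , T≤p , from-offset N (return⇒periodic ret)

    ∞⇒eventually-∞ : ∀ N → u N ≡ ∞ → EventuallyInfinity u
    ∞⇒eventually-∞ N uN≡∞ = N , from-offset N (fixed-point-absorbs refl uN≡∞)

    0⇒eventually-∞ : ∀ N → u N ≡ fin 0ℚ → EventuallyInfinity u
    0⇒eventually-∞ N uN≡0 = ∞⇒eventually-∞ (suc N) (trans (u-suc N) (cong step uN≡0))

    eventually-∞⇒eventuallyPeriodic : EventuallyInfinity u → EventuallyPeriodicWithPeriod≤ p u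
    eventually-∞⇒eventuallyPeriodic (N , ∞-from-N) =
      N , 1 , ℕP.≤-refl , s≤s z≤n , λ n N≤n →
        trans (∞-from-N (suc n) (ℕP.m≤n⇒m≤1+n N≤n)) (sym (∞-from-N n N≤n))

    -- While the offset is prime to p, y plus the offset has valuation 0 and the step lowers
    -- the offset by one.
    descend : ∀ y → + 1 ≤ᶻ v y → ∀ d r N → (∀ j → j ℕ.< d → ¬ (p ∣ suc (j ℕ.+ r))) →
              u N ≡ fin (y ℚ.+ fromℤ (+ (d ℕ.+ r))) → u (d ℕ.+ N) ≡ fin (y ℚ.+ fromℤ (+ r))
    descend y 1≤vy zero    r N _  uN≡ = uN≡
    descend y 1≤vy (suc d) r N p∤ uN≡ = trans (cong u (sym (ℕP.+-suc d N)))
      (descend y 1≤vy d r (suc N) (λ j j<d → p∤ j (ℕP.m<n⇒m<1+n j<d))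
        (trans (u-suc N) (trans (cong step uN≡) (step-down (d ℕ.+ r) 1≤vy (p∤ d ℕP.≤-refl)))))

    descend-to-0 : ∀ y → + 1 ≤ᶻ v y → ∀ d N → d ℕ.< p →
                   u N ≡ fin (y ℚ.+ fromℤ (+ d)) → u (d ℕ.+ N) ≡ fin y
    descend-to-0 y 1≤vy d N d<p uN≡ =
      trans (descend y 1≤vy d 0 N p∤ (subst (λ n → u N ≡ fin (y ℚ.+ fromℤ (+ n))) (sym (ℕP.+-identityʳ d)) uN≡))
            (cong fin (ℚP.+-identityʳ y))
      where
        p∤ : ∀ j → j ℕ.< d → ¬ (p ∣ suc (j ℕ.+ 0))
        p∤ j j<d = small⇒∤ _ (s≤s z≤n)
          (ℕP.≤-<-trans (ℕP.≤-trans (s≤s (ℕP.≤-reflexive (ℕP.+-identityʳ j))) j<d) d<p)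

    after-positive : ∀ {y a} N → v y ≡ int (+ suc a) → u N ≡ fin y → u (suc N) ≡ fin (y ℚ.+ fromℤ (+ a))
    after-positive N vy≡ uN≡y = trans (u-suc N) (trans (cong step uN≡y) (step-fin vy≡))

    returns-after-valuation : ∀ {y} a N → v y ≡ int (+ suc a) → suc a ℕ.≤ p → u N ≡ fin y →
                              u (suc a ℕ.+ N) ≡ u N
    returns-after-valuation {y} a N vy≡ a<p uN≡y = begin
      u (suc a ℕ.+ N) ≡⟨ cong u (ℕP.+-suc a N) ⟨
      u (a ℕ.+ suc N) ≡⟨ descend-to-0 y 1≤vy a (suc N) a<p (after-positive N vy≡ uN≡y) ⟩
      fin y           ≡⟨ uN≡y ⟨
      u N             ∎
      where 1≤vy = ≤ᶻ-weaken (v y) (ℤ.+≤+ (s≤s z≤n)) (≤ᶻ-reflexive vy≡)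

    positive⇒eventuallyPeriodic : ∀ t → 0 ℕ.< t → ∀ {y N} → v y ≡ int (+ t) → u N ≡ fin y →
                                  EventuallyPeriodicWithPeriod≤ p u
    positive⇒eventuallyPeriodic = <-rec P periodic-or-smaller
      where
        P : ℕ → Set
        P t = 0 ℕ.< t → ∀ {y N} → v y ≡ int (+ t) → u N ≡ fin y → EventuallyPeriodicWithPeriod≤ p u
        periodic-or-smaller : ∀ t → (∀ {s} → s ℕ.< t → P s) → P t
        periodic-or-smaller (suc a) rec _ {y} {N} vy≡ uN≡y with suc a ℕ.≤? p
        ... | yes t≤p =
          return⇒eventuallyPeriodic N (suc a) (s≤s z≤n) t≤p (returns-after-valuation a N vy≡ t≤p uN≡y)
        ... | no  t≰p = rec s<t 0<s vy+m≡s u≡y+m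
          where
            m = a ℕ./ p ℕ.* p
            p≤m : p ℕ.≤ m
            p≤m = ℕP.≤-trans (ℕP.≤-reflexive (sym (ℕP.*-identityˡ p)))
                    (ℕP.*-monoˡ-≤ p (ℕDM.m≥n⇒m/n>0 (ℕP.≤-pred (ℕP.≰⇒> t≰p))))
            instance
              m≢0 : ℕ.NonZero m
              m≢0 = ℕ.>-nonZero (ℕP.<-≤-trans (s≤s z≤n) p≤m)
            s = mult p m
            0<s : 0 ℕ.< s
            0<s = ∣⇒mult>0 m (n∣m*n (a ℕ./ p))
            s<t : s ℕ.< suc a
            s<t = s≤s (ℕP.≤-trans (ℕP.<⇒≤ (mult-< m)) (ℕDM.m/n*n≤m a p))
            1≤vy = ≤ᶻ-weaken (v y) (ℤ.+≤+ (s≤s z≤n)) (≤ᶻ-reflexive vy≡)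
            u≡y+m : u (a ℕ.% p ℕ.+ suc N) ≡ fin (y ℚ.+ fromℤ (+ m))
            u≡y+m = descend y 1≤vy (a ℕ.% p) m (suc N)
              (λ j j<r → small+multiple⇒∤ (suc j) (a ℕ./ p) (s≤s z≤n) (ℕP.≤-<-trans j<r (ℕDM.m%n<n a p)))
              (subst (λ n → u (suc N) ≡ fin (y ℚ.+ fromℤ (+ n))) (ℕDM.m≡m%n+[m/n]*n a p)
                     (after-positive N vy≡ uN≡y))
            vy+m≡s : v (y ℚ.+ fromℤ (+ m)) ≡ int (+ s)
            vy+m≡s = trans (cong v (ℚP.+-comm y (fromℤ (+ m))))
              (v-strict (fromℤ (+ m)) y (v-fromℤ (+ m)) (subst (ℤ.suc (+ s) ≤ᶻ_) (sym vy≡) (ℤ.+≤+ s<t)))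

    ≥1⇒eventuallyPeriodic : ∀ y {N} → + 1 ≤ᶻ v y → u N ≡ fin y → EventuallyPeriodicWithPeriod≤ p u
    ≥1⇒eventuallyPeriodic y {N} 1≤vy uN≡y with v y in vy≡ | 1≤vy
    ... | ∞ᶻ           | _ =
      eventually-∞⇒eventuallyPeriodic (0⇒eventually-∞ N (trans uN≡y (cong fin (v≡∞⇒≡0 y vy≡))))
    ... | int +[1+ a ] | _ = positive⇒eventuallyPeriodic (suc a) (s≤s z≤n) vy≡ uN≡y
    ... | int (+ zero) | ℤ.+≤+ ()

    nonneg⇒eventuallyPeriodic : Prime p → ∀ N {q} → + 0 ≤ᶻ v q → u N ≡ fin q →
                                EventuallyPeriodicWithPeriod≤ p u
    nonneg⇒eventuallyPeriodic p-prime N {q} 0≤vq uN≡q with 0≤ᶻ⇒≡0⊎1≤ᶻ (v q) 0≤vq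
    ... | inj₂ 1≤vq = ≥1⇒eventuallyPeriodic q 1≤vq uN≡q
    -- A `with` on residue … would make Agda unfold the Bézout computation and run out of memory.
    ... | inj₁ vq≡0 = via-residue (residue p-prime q vq≡0)
      where
        via-residue : (∃ λ r → r ℕ.< p × + 1 ≤ᶻ v (q ℚ.- fromℤ (+ r))) →
                      EventuallyPeriodicWithPeriod≤ p u
        via-residue (r , r<p , 1≤v[q-r]) = ≥1⇒eventuallyPeriodic (q ℚ.- fromℤ (+ r)) 1≤v[q-r]
          (descend-to-0 (q ℚ.- fromℤ (+ r)) 1≤v[q-r] r N r<p
            (trans uN≡q (cong fin (sym (a-b+b≡a q (fromℤ (+ r)))))))

    negative-drift : ∀ {q c} → c ℤ.< + 0 → v q ≡ int c → u 0 ≡ fin q →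
                     ∀ n → ∃ λ z → z ℤ.≤ ℤ.- + n × v (q ℚ.+ fromℤ z) ≡ int c × u n ≡ fin (q ℚ.+ fromℤ z)
    negative-drift {q} {c} c<0 vq≡c u0≡q zero =
      + 0 , ℤP.≤-refl , trans (cong v (ℚP.+-identityʳ q)) vq≡c , trans u0≡q (cong fin (sym (ℚP.+-identityʳ q)))
    negative-drift {q} {c} c<0 vq≡c u0≡q (suc n) with negative-drift c<0 vq≡c u0≡q n
    ... | z , z≤-n , v≡c , un≡ = z ℤ.+ (c ℤ.- + 1) , z′≤-n-1 ,
            trans (cong v (sym (+-fromℤ-assoc q z (c ℤ.- + 1))))
              (v-strict (q ℚ.+ fromℤ z) (fromℤ (c ℤ.- + 1)) v≡c
                (≤ᶻ-weaken (v (fromℤ (c ℤ.- + 1))) (ℤP.i<j⇒suc[i]≤j c<0) (v-fromℤ-nonneg (c ℤ.- + 1)))) ,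
            trans (u-suc n) (trans (cong step un≡) (step-shift q z v≡c))
      where
        z′≤-n-1 : z ℤ.+ (c ℤ.- + 1) ℤ.≤ ℤ.- + suc n
        z′≤-n-1 = ℤP.≤-trans (ℤP.+-mono-≤ z≤-n (ℤP.+-monoˡ-≤ (ℤ.- + 1) (ℤP.<⇒≤ c<0)))
          (ℤP.≤-reflexive (solve 1 (λ n → :- n :+ :- con (+ 1) := :- (con (+ 1) :+ n)) refl (+ n)))
          where open ℤS.+-*-Solver

    negative⇒diverges : ∀ {q c} → c ℤ.< + 0 → v q ≡ int c → u 0 ≡ fin q → ConvergesToMinusInfinity u
    negative⇒diverges {q} {c} c<0 vq≡c u0≡q M = below-from (archimedean q M)
      where
        below-from : (∃ λ N → q ℚ.+ fromℤ (ℤ.- + N) ℚ.< M) → ∃ λ N → ∀ n → N ℕ.≤ n → u n <∞ fin M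
        below-from (N , q-N<M) = N , λ n N≤n →
          let z , z≤-n , _ , un≡ = negative-drift c<0 vq≡c u0≡q n
          in subst (_<∞ fin M) (sym un≡) (ℚP.≤-<-trans
               (ℚP.+-monoʳ-≤ q (fromℤ-mono-≤ (ℤP.≤-trans z≤-n (ℤP.neg-mono-≤ (ℤ.+≤+ N≤n))))) q-N<M)

    small⇒eventually-∞ : ∀ N {j} → j ℕ.< p → u N ≡ fin (fromℤ (+ j)) → EventuallyInfinity u
    small⇒eventually-∞ N {j} j<p uN≡j =
      0⇒eventually-∞ (j ℕ.+ N) (descend-to-0 0ℚ tt j N j<p (trans uN≡j (cong fin (sym (ℚP.+-identityˡ _)))))

    walk-back : ∀ n j → j ℕ.< p → u n ≡ fin (fromℤ (+ j)) →
                ∃ λ i → i ℕ.< p × u 0 ≡ fin (fromℤ (+ i))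
    walk-back zero    j j<p u0≡j = j , j<p , u0≡j
    walk-back (suc n) j j<p u≡j with step-preimage-small (u n) j j<p (trans (sym (u-suc n)) u≡j)
    ... | un≡1+j , 1+j<p = walk-back n (suc j) 1+j<p un≡1+j

    ∞⇒starts-∞-or-hits-0 : ∀ N → u N ≡ ∞ → u 0 ≡ ∞ ⊎ ∃ λ n → u n ≡ fin 0ℚ
    ∞⇒starts-∞-or-hits-0 zero    u0≡∞ = inj₁ u0≡∞
    ∞⇒starts-∞-or-hits-0 (suc N) u≡∞ with u N in uN≡
    ... | ∞     = ∞⇒starts-∞-or-hits-0 N uN≡
    ... | fin w = inj₂ (N , trans uN≡ (cong fin (step≡∞⇒≡0 w step[w]≡∞)))
      where step[w]≡∞ = trans (cong step (sym uN≡)) (trans (sym (u-suc N)) u≡∞)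

    eventually-∞⇒small-start : EventuallyInfinity u →
                               u 0 ≡ ∞ ⊎ ∃ λ i → i ℕ.< p × u 0 ≡ fin (fromℤ (+ i))
    eventually-∞⇒small-start (N , ∞-from-N) with ∞⇒starts-∞-or-hits-0 N (∞-from-N N ℕP.≤-refl)
    ... | inj₁ u0≡∞        = inj₁ u0≡∞
    ... | inj₂ (n , un≡0) = inj₂ (walk-back n 0 (s≤s z≤n) un≡0)

theorem1p3 : ∀ {c ℓ : Level} (p : ℕ) → Prime p → (K : ValuedExtension p c ℓ) →
    let open ValuedExtension K in
    ∀ (x : Carrier) →
      (((∃ λ q → ν x ≡ fin q × fin 0ℚ ≤∞ νp p q) ⊎ ν x ≡ fin 0ℚ ⊎ ν x ≡ ∞)
        → EventuallyPeriodicWithPeriod≤ p (νseq x))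
      × ((∃ λ q → ν x ≡ fin q × νp p q <∞ fin 0ℚ)
        → ConvergesToMinusInfinity (νseq x))
      × (EventuallyInfinity (νseq x)
        ⇔ (ν x ≡ ∞ ⊎ (∃ λ k → k ℕ.< p × ν x ≡ fin ((+ k) ℚ./ 1))))
theorem1p3 zero          p-prime with () ← prime⇒nonTrivial p-prime
theorem1p3 (suc zero)    p-prime with () ← prime⇒nonTrivial p-prime
theorem1p3 (suc (suc k)) p-prime K x =
    (λ { (inj₁ (q , νx≡q , 0≤νq)) →
           nonneg⇒eventuallyPeriodic p-prime 0 (νp-nonneg⇒ q 0≤νq) νx≡q
       ; (inj₂ (inj₁ νx≡0)) → eventually-∞⇒eventuallyPeriodic (0⇒eventually-∞ 0 νx≡0)
       ; (inj₂ (inj₂ νx≡∞)) → eventually-∞⇒eventuallyPeriodic (∞⇒eventually-∞ 0 νx≡∞) })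
  , (λ (q , νx≡q , νq<0) → let c , c<0 , vq≡c = νp-negative⇒ q νq<0 in negative⇒diverges c<0 vq≡c νx≡q)
  , mk⇔ eventually-∞⇒small-start
        [ ∞⇒eventually-∞ 0 , (λ (j , j<p , νx≡j) → small⇒eventually-∞ 0 j<p νx≡j) ]
  where
    open PAdicValuation k
    open InExtension k K
    open StepOrbit (ValuedExtension.νseq K x) (λ n → ν-D (ValuedExtension.Diter K n x))
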